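{- Let $A,B$ be representable thin concurrent games. Then (1) $A^\perp$ is representable, and (2) $A\parallel B$ is representable.
   Context: Thin concurrent games (tcgs) are as in Castellan, Clairambault, Rideau, Winskel, "Games and strategies as event structures" (LMCS 2017): an event structure with polarities with configurations $\mathscr{C}(A)$ and isomorphism families of symmetries $\cong_A$, positive symmetries $\cong_A^+$ and negative symmetries $\cong_A^-$. For $x\in\mathscr{C}(A)$, $\mathsf{S}(x),\mathsf{P}(x),\mathsf{N}(x)$ are the groups of endosymmetries, positive endosymmetries, negative endosymmetries of $x$. A configuration $x$ is canonical if every $\theta\in\mathsf{S}(x)$ factors uniquely as $\theta=\theta_+\circ\theta_-$ with $\theta_-\in\mathsf{N}(x)$ and $\theta_+\in\mathsf{P}(x)$. A tcg is representable if every equivalence class of configurations under symmetry contains a canonical configuration. The dual $A^\perp$ has the same events, configurations and symmetries as $A$, reversed polarities, and $\cong^+_{A^\perp}=\cong^-_A$, $\cong^-_{A^\perp}=\cong^+_A$. The parallel composition $A\parallel B$ has configurations $x_A\parallel x_B$ and symmetries (resp. positive, negative) exactly the $\theta_A\parallel\theta_B$ with $\theta_A,\theta_B$ symmetries (resp. positive, negative). -}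

module Defs where

open import Data.Empty using (⊥)
open import Data.Unit using (⊤)
open import Data.Product using (Σ; Σ-syntax; _×_; _,_)
open import Data.Sum using (_⊎_; inj₁; inj₂)
open import Data.List using (List)
open import Data.List.Membership.Propositional using (_∈_)
open import Relation.Binary.PropositionalEquality using (_≡_)
open import Relation.Nullary using (¬_)

Subset : Set → Set₁
Subset E = E → Set

BRel : Set → Set₁
BRel E = E → E → Set

module _ {E : Set} where

  _⊆_ : Subset E → Subset E → Set
  X ⊆ Y = ∀ e → X e → Y e

  Finite : Subset E → Set
  Finite X = Σ (List E) λ l → ∀ e → (X e → e ∈ l) × (e ∈ l → X e)

  ∅ : Subset E
  ∅ _ = ⊥

  ⟦_⟧ : E → Subset E
  ⟦ e ⟧ e' = e' ≡ e

  _∪_ : Subset E → Subset E → Subset E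
  (X ∪ Y) e = X e ⊎ Y e

  _⊆R_ : BRel E → BRel E → Set
  θ ⊆R ψ = ∀ a b → θ a b → ψ a b

  _≈R_ : BRel E → BRel E → Set
  θ ≈R ψ = θ ⊆R ψ × ψ ⊆R θ

  -- composition  ψ ⊙ θ  (first θ, then ψ), inverse, identity, restriction
  _⊙_ : BRel E → BRel E → BRel E
  (ψ ⊙ θ) a c = Σ[ b ∈ E ] (θ a b × ψ b c)

  _⁻¹ : BRel E → BRel E
  (θ ⁻¹) a b = θ b a

  idR : Subset E → BRel E
  idR x a b = x a × a ≡ b

  restrict : BRel E → Subset E → BRel E
  restrict θ x' a b = x' a × θ a b

  record IsBij (x y : Subset E) (θ : BRel E) : Set where
    field
      dom⊆  : ∀ a b → θ a b → x a × y b
      total : ∀ a → x a → Σ[ b ∈ E ] θ a b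
      surj  : ∀ b → y b → Σ[ a ∈ E ] θ a b
      func  : ∀ a b b' → θ a b → θ a b' → b ≡ b'
      inj   : ∀ a a' b → θ a b → θ a' b → a ≡ a'

data Pol : Set where
  pos neg : Pol

flipPol : Pol → Pol
flipPol pos = neg
flipPol neg = pos

-- Raw data of a game: event structure with polarities (E, ≤, Con, pol)
-- together with symmetries ≅, positive symmetries ≅⁺, negative ≅⁻
-- (each a predicate on sets of pairs).

record GameData : Set₂ where
  field
    Ev   : Set
    _≤_  : Ev → Ev → Set
    Con  : Subset Ev → Set
    pol  : Ev → Pol
    Sym  : BRel Ev → Set₁
    Sym⁺ : BRel Ev → Set₁
    Sym⁻ : BRel Ev → Set₁

module _ (A : GameData) where
  open GameData A

  IsConfig : Subset Ev → Set
  IsConfig x = Con x × (∀ e e' → x e → e' ≤ e → x e')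

  ExtBy : Pol → BRel Ev → BRel Ev → Set
  ExtBy p θ θ' = θ ⊆R θ' × (∀ a b → θ' a b → ¬ θ a b → pol a ≡ p)

  record IsIsoFamily (S : BRel Ev → Set₁) : Set₁ where
    field
      bij      : ∀ θ → S θ → Σ[ x ∈ Subset Ev ] Σ[ y ∈ Subset Ev ]
                   (IsConfig x × IsConfig y × IsBij x y θ)
      ext-eq   : ∀ θ θ' → S θ → θ ≈R θ' → S θ'
      identity : ∀ x → IsConfig x → S (idR x)
      inverse  : ∀ θ → S θ → S (θ ⁻¹)
      compose  : ∀ x y z θ ψ → S θ → IsBij x y θ → S ψ → IsBij y z ψ → S (ψ ⊙ θ)
      restr    : ∀ x y x' θ → S θ → IsBij x y θ → IsConfig x' → x' ⊆ x →
                   S (restrict θ x')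
      extend   : ∀ x y x' θ → S θ → IsBij x y θ → IsConfig x' → x ⊆ x' →
                   Σ[ θ' ∈ BRel Ev ] Σ[ y' ∈ Subset Ev ]
                     (IsConfig y' × S θ' × IsBij x' y' θ' × θ ⊆R θ')

  record IsTcg : Set₁ where
    field
      ≤-refl    : ∀ e → e ≤ e
      ≤-trans   : ∀ e₁ e₂ e₃ → e₁ ≤ e₂ → e₂ ≤ e₃ → e₁ ≤ e₃
      ≤-antisym : ∀ e₁ e₂ → e₁ ≤ e₂ → e₂ ≤ e₁ → e₁ ≡ e₂
      fin-causes : ∀ e → Finite (λ e' → e' ≤ e)
      con-finite : ∀ X → Con X → Finite X
      con-empty  : Con ∅
      con-single : ∀ e → Con ⟦ e ⟧
      con-sub    : ∀ X Y → Con Y → X ⊆ Y → Finite X → Con X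
      con-down   : ∀ X e e' → Con X → X e → e' ≤ e → Con (X ∪ ⟦ e' ⟧)
      isoS  : IsIsoFamily Sym
      isoS⁺ : IsIsoFamily Sym⁺
      isoS⁻ : IsIsoFamily Sym⁻
      S⁺⊆S  : ∀ θ → Sym⁺ θ → Sym θ
      S⁻⊆S  : ∀ θ → Sym⁻ θ → Sym θ
      S-pol : ∀ θ a b → Sym θ → θ a b → pol a ≡ pol b
      S⁺∩S⁻-id : ∀ θ → Sym⁺ θ → Sym⁻ θ → ∀ a b → θ a b → a ≡ b
      S⁻-negext : ∀ θ θ' → Sym⁻ θ → ExtBy neg θ θ' → Sym θ' → Sym⁻ θ'
      S⁺-posext : ∀ θ θ' → Sym⁺ θ → ExtBy pos θ θ' → Sym θ' → Sym⁺ θ'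
      thin : ∀ x θ → IsConfig x → ExtBy pos (idR x) θ → Sym⁻ θ →
               ∀ a b → θ a b → a ≡ b

  Endo : (BRel Ev → Set₁) → Subset Ev → BRel Ev → Set₁
  Endo S x θ = S θ × IsBij x x θ

  Canonical : Subset Ev → Set₁
  Canonical x =
    ∀ θ → Endo Sym x θ →
      (Σ[ θ₊ ∈ BRel Ev ] Σ[ θ₋ ∈ BRel Ev ]
         (Endo Sym⁺ x θ₊ × Endo Sym⁻ x θ₋ × θ ≈R (θ₊ ⊙ θ₋)))
      × (∀ θ₊ θ₋ ψ₊ ψ₋ → Endo Sym⁺ x θ₊ → Endo Sym⁻ x θ₋ →
           Endo Sym⁺ x ψ₊ → Endo Sym⁻ x ψ₋ →
           θ ≈R (θ₊ ⊙ θ₋) → θ ≈R (ψ₊ ⊙ ψ₋) →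
           (θ₊ ≈R ψ₊) × (θ₋ ≈R ψ₋))

  _≅c_ : Subset Ev → Subset Ev → Set₁
  x ≅c y = Σ[ θ ∈ BRel Ev ] (Sym θ × IsBij x y θ)

  Representable : Set₁
  Representable = ∀ x → IsConfig x →
    Σ[ y ∈ Subset Ev ] (IsConfig y × x ≅c y × Canonical y)

_⊥ : GameData → GameData
A ⊥ = record
  { Ev = Ev ; _≤_ = _≤_ ; Con = Con
  ; pol = λ e → flipPol (pol e)
  ; Sym = Sym ; Sym⁺ = Sym⁻ ; Sym⁻ = Sym⁺ }
  where open GameData A

module _ {EA EB : Set} where

  ≤∥ : (EA → EA → Set) → (EB → EB → Set) → EA ⊎ EB → EA ⊎ EB → Set
  ≤∥ la lb (inj₁ a) (inj₁ a') = la a a'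
  ≤∥ la lb (inj₂ b) (inj₂ b') = lb b b'
  ≤∥ la lb _ _ = ⊥

  _∥R_ : BRel EA → BRel EB → BRel (EA ⊎ EB)
  (θA ∥R θB) (inj₁ a) (inj₁ a') = θA a a'
  (θA ∥R θB) (inj₂ b) (inj₂ b') = θB b b'
  (θA ∥R θB) _ _ = ⊥

  polSum : (EA → Pol) → (EB → Pol) → EA ⊎ EB → Pol
  polSum pa pb (inj₁ a) = pa a
  polSum pa pb (inj₂ b) = pb b

  Sym∥ : (BRel EA → Set₁) → (BRel EB → Set₁) → BRel (EA ⊎ EB) → Set₁
  Sym∥ SA SB θ = Σ[ θA ∈ BRel EA ] Σ[ θB ∈ BRel EB ]
                   (SA θA × SB θB × θ ≈R (θA ∥R θB))

_∥_ : GameData → GameData → GameData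
A ∥ B = record
  { Ev   = A.Ev ⊎ B.Ev
  ; _≤_  = ≤∥ A._≤_ B._≤_
  ; Con  = λ X → A.Con (λ a → X (inj₁ a)) × B.Con (λ b → X (inj₂ b))
  ; pol  = polSum A.pol B.pol
  ; Sym  = λ θ → Sym∥ A.Sym B.Sym θ
  ; Sym⁺ = λ θ → Sym∥ A.Sym⁺ B.Sym⁺ θ
  ; Sym⁻ = λ θ → Sym∥ A.Sym⁻ B.Sym⁻ θ }
  where
    module A = GameData A
    module B = GameData B

module Submission where

-- Both constructions leave the configurations essentially unchanged, so a
-- representable game keeps its canonical representatives: for A⊥ the very
-- same configuration y is canonical, and for A ∥ B the configuration
-- yA ∥ yB built from canonical yA, yB is canonical.
--
-- A⊥ swaps the roles of positive and negative symmetries.  An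
-- endosymmetry θ of y factors as θ = θ₋⁻¹ ∘ θ₊⁻¹ where θ⁻¹ = θ₊ ∘ θ₋ is
-- the factorisation of θ⁻¹ in A; uniqueness is transported the same way.
--
-- Every symmetry of A ∥ B is θA ∥ θB, and _∥R_
-- commutes with composition and is injective up to extensional equality;
-- so factorisations in A ∥ B are exactly pairs of factorisations in A and
-- in B.  No axiom of thin concurrent games is needed for this part.

open import Defs
open import Level using (0ℓ; suc)
open import Data.Product using (Σ-syntax; _×_; _,_; proj₁; proj₂)
open import Data.Sum using (_⊎_; inj₁; inj₂)
open import Data.Sum.Properties using (inj₁-injective; inj₂-injective)
open import Data.Empty using (⊥-elim)
open import Relation.Binary.Bundles using (Setoid)
open import Relation.Binary.PropositionalEquality using (_≡_; cong)

module _ {E : Set} where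

  ≈R-setoid : Setoid (suc 0ℓ) 0ℓ
  ≈R-setoid = record
    { Carrier = BRel E
    ; _≈_ = _≈R_
    ; isEquivalence = record
      { refl  = (λ _ _ p → p) , (λ _ _ p → p)
      ; sym   = λ (f , g) → g , f
      ; trans = λ (f , g) (h , k) →
                  (λ a b p → h a b (f a b p)) , (λ a b p → g a b (k a b p)) } }

  open Setoid ≈R-setoid public
    using () renaming (refl to ≈R-refl; sym to ≈R-sym; trans to ≈R-trans)

  ⁻¹-cong : {θ ψ : BRel E} → θ ≈R ψ → (θ ⁻¹) ≈R (ψ ⁻¹)
  ⁻¹-cong (f , g) = (λ a b → f b a) , (λ a b → g b a)

  ⊙-cong : {θ θ' ψ ψ' : BRel E} → ψ ≈R ψ' → θ ≈R θ' → (ψ ⊙ θ) ≈R (ψ' ⊙ θ')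
  ⊙-cong (f , g) (h , k) =
    (λ { a c (b , p , q) → b , h a b p , f b c q }) ,
    (λ { a c (b , p , q) → b , k a b p , g b c q })

  -- inverting a factorisation reverses its factors; since (θ ⁻¹) ⁻¹ is
  -- definitionally θ, this also turns a factorisation of θ ⁻¹ into one of θ
  ⁻¹-factorisation : {θ ψ φ : BRel E} →
                     θ ≈R (ψ ⊙ φ) → (θ ⁻¹) ≈R ((φ ⁻¹) ⊙ (ψ ⁻¹))
  ⁻¹-factorisation e = ≈R-trans (⁻¹-cong e) swap
    where
      swap : {ψ φ : BRel E} → ((ψ ⊙ φ) ⁻¹) ≈R ((φ ⁻¹) ⊙ (ψ ⁻¹))
      swap = (λ { _ _ (b , p , q) → b , q , p }) , (λ { _ _ (b , p , q) → b , q , p })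

  IsBij-⁻¹ : {x y : Subset E} {θ : BRel E} → IsBij x y θ → IsBij y x (θ ⁻¹)
  IsBij-⁻¹ bθ = record
    { dom⊆ = λ a b p → proj₂ (dom⊆ b a p) , proj₁ (dom⊆ b a p)
    ; total = surj
    ; surj = total
    ; func = λ a b b' → inj b b' a
    ; inj = λ a a' b → func b a a' }
    where open IsBij bθ

module _ (A : GameData) where
  open GameData A

  Factorisation : Subset Ev → BRel Ev → Set₁
  Factorisation x θ = Σ[ θ₊ ∈ BRel Ev ] Σ[ θ₋ ∈ BRel Ev ]
    (Endo A Sym⁺ x θ₊ × Endo A Sym⁻ x θ₋ × θ ≈R (θ₊ ⊙ θ₋))

  UniqueFactorisation : Subset Ev → BRel Ev → Set₁
  UniqueFactorisation x θ = ∀ θ₊ θ₋ ψ₊ ψ₋ →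
    Endo A Sym⁺ x θ₊ → Endo A Sym⁻ x θ₋ → Endo A Sym⁺ x ψ₊ → Endo A Sym⁻ x ψ₋ →
    θ ≈R (θ₊ ⊙ θ₋) → θ ≈R (ψ₊ ⊙ ψ₋) → (θ₊ ≈R ψ₊) × (θ₋ ≈R ψ₋)

  -- these are chosen so that  Canonical A x  is definitionally
  -- ∀ θ → Endo A Sym x θ → Factorisation x θ × UniqueFactorisation x θ

  Endo-⁻¹ : {S : BRel Ev → Set₁} {x : Subset Ev} {θ : BRel Ev} →
            IsIsoFamily A S → Endo A S x θ → Endo A S x (θ ⁻¹)
  Endo-⁻¹ iso (s , b) = IsIsoFamily.inverse iso _ s , IsBij-⁻¹ b

-- in A⊥ positive and negative endosymmetries swap, so a canonical
-- configuration of A stays canonical in A⊥ by inverting factorisations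
canonical-⊥ : (A : GameData) → IsTcg A → (y : Subset (GameData.Ev A)) →
              Canonical A y → Canonical (A ⊥) y
canonical-⊥ A tcg y can θ endo = factorisation , uniqueness
  where
    open IsTcg tcg using (isoS; isoS⁺; isoS⁻)
    canInv : Factorisation A y (θ ⁻¹) × UniqueFactorisation A y (θ ⁻¹)
    canInv = can (θ ⁻¹) (Endo-⁻¹ A isoS endo)

    factorisation : Factorisation (A ⊥) y θ
    factorisation =
      let (θ₊ , θ₋ , e₊ , e₋ , eq) = proj₁ canInv
      in  θ₋ ⁻¹ , θ₊ ⁻¹ , Endo-⁻¹ A isoS⁻ e₋ , Endo-⁻¹ A isoS⁺ e₊ , ⁻¹-factorisation eq

    uniqueness : UniqueFactorisation (A ⊥) y θ
    uniqueness θ₊ θ₋ ψ₊ ψ₋ t₊ t₋ u₊ u₋ eθ eψ =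
      let (θ₋≈ψ₋ , θ₊≈ψ₊) =
            proj₂ canInv (θ₋ ⁻¹) (θ₊ ⁻¹) (ψ₋ ⁻¹) (ψ₊ ⁻¹)
              (Endo-⁻¹ A isoS⁺ t₋) (Endo-⁻¹ A isoS⁻ t₊)
              (Endo-⁻¹ A isoS⁺ u₋) (Endo-⁻¹ A isoS⁻ u₊)
              (⁻¹-factorisation eθ) (⁻¹-factorisation eψ)
      in  ⁻¹-cong θ₊≈ψ₊ , ⁻¹-cong θ₋≈ψ₋

representable-⊥ : (A : GameData) → IsTcg A → Representable A → Representable (A ⊥)
representable-⊥ A tcg rep x cx =
  let (y , cy , x≅y , can) = rep x cx
  in  y , cy , x≅y , canonical-⊥ A tcg y can

module _ {EA EB : Set} where

  left : Subset (EA ⊎ EB) → Subset EA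
  left X a = X (inj₁ a)

  right : Subset (EA ⊎ EB) → Subset EB
  right X b = X (inj₂ b)

  _⊎ₛ_ : Subset EA → Subset EB → Subset (EA ⊎ EB)
  (X ⊎ₛ Y) (inj₁ a) = X a
  (X ⊎ₛ Y) (inj₂ b) = Y b

  ∥-cong : {θA ψA : BRel EA} {θB ψB : BRel EB} → θA ≈R ψA → θB ≈R ψB →
           (θA ∥R θB) ≈R (ψA ∥R ψB)
  ∥-cong (f , g) (h , k) = mono f h , mono g k
    where
      mono : {θA ψA : BRel EA} {θB ψB : BRel EB} → θA ⊆R ψA → θB ⊆R ψB →
             (θA ∥R θB) ⊆R (ψA ∥R ψB)
      mono f h (inj₁ a) (inj₁ b) p = f a b p
      mono f h (inj₂ a) (inj₂ b) p = h a b p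

  ∥-injective : {θA ψA : BRel EA} {θB ψB : BRel EB} →
                (θA ∥R θB) ≈R (ψA ∥R ψB) → (θA ≈R ψA) × (θB ≈R ψB)
  ∥-injective (f , g) =
    ((λ a b → f (inj₁ a) (inj₁ b)) , (λ a b → g (inj₁ a) (inj₁ b))) ,
    ((λ a b → f (inj₂ a) (inj₂ b)) , (λ a b → g (inj₂ a) (inj₂ b)))

  ∥-⊙ : {ψA φA : BRel EA} {ψB φB : BRel EB} →
        ((ψA ∥R ψB) ⊙ (φA ∥R φB)) ≈R ((ψA ⊙ φA) ∥R (ψB ⊙ φB))
  ∥-⊙ = split , merge
    where
      split : {ψA φA : BRel EA} {ψB φB : BRel EB} →
              ((ψA ∥R ψB) ⊙ (φA ∥R φB)) ⊆R ((ψA ⊙ φA) ∥R (ψB ⊙ φB))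
      split (inj₁ a) (inj₁ c) (inj₁ b , p , q) = b , p , q
      split (inj₂ a) (inj₂ c) (inj₂ b , p , q) = b , p , q
      split (inj₁ a) c        (inj₂ b , () , q)
      split (inj₂ a) c        (inj₁ b , () , q)
      split (inj₁ a) (inj₂ c) (inj₁ b , p , ())
      split (inj₂ a) (inj₁ c) (inj₂ b , p , ())

      merge : {ψA φA : BRel EA} {ψB φB : BRel EB} →
              ((ψA ⊙ φA) ∥R (ψB ⊙ φB)) ⊆R ((ψA ∥R ψB) ⊙ (φA ∥R φB))
      merge (inj₁ a) (inj₁ c) (b , p , q) = inj₁ b , p , q
      merge (inj₂ a) (inj₂ c) (b , p , q) = inj₂ b , p , q

  ∥-factorisation-components :
    {θ θ₊ θ₋ : BRel (EA ⊎ EB)} {θA a₊ a₋ : BRel EA} {θB b₊ b₋ : BRel EB} →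
    θ ≈R (θA ∥R θB) → θ₊ ≈R (a₊ ∥R b₊) → θ₋ ≈R (a₋ ∥R b₋) → θ ≈R (θ₊ ⊙ θ₋) →
    (θA ≈R (a₊ ⊙ a₋)) × (θB ≈R (b₊ ⊙ b₋))
  ∥-factorisation-components {θ} {θ₊} {θ₋} {θA} {a₊} {a₋} {θB} {b₊} {b₋} e e₊ e₋ eθ =
    ∥-injective
    (begin
      θA ∥R θB                   ≈⟨ ≈R-sym e ⟩
      θ                          ≈⟨ eθ ⟩
      θ₊ ⊙ θ₋                    ≈⟨ ⊙-cong e₊ e₋ ⟩
      (a₊ ∥R b₊) ⊙ (a₋ ∥R b₋)    ≈⟨ ∥-⊙ ⟩
      (a₊ ⊙ a₋) ∥R (b₊ ⊙ b₋)     ∎)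
    where open import Relation.Binary.Reasoning.Setoid ≈R-setoid

  IsBij-left : {x y : Subset (EA ⊎ EB)} {θ : BRel (EA ⊎ EB)}
               {θA : BRel EA} {θB : BRel EB} →
               IsBij x y θ → θ ≈R (θA ∥R θB) → IsBij (left x) (left y) θA
  IsBij-left {θ = θ} {θA} bθ (f , g) = record
    { dom⊆ = λ a b p → dom⊆ (inj₁ a) (inj₁ b) (g _ _ p)
    ; total = λ a xa → image a (total (inj₁ a) xa)
    ; surj = λ b yb → preimage b (surj (inj₁ b) yb)
    ; func = λ a b b' p q → inj₁-injective
        (func _ _ _ (g (inj₁ a) (inj₁ b) p) (g (inj₁ a) (inj₁ b') q))
    ; inj = λ a a' b p q → inj₁-injective
        (inj _ _ _ (g (inj₁ a) (inj₁ b) p) (g (inj₁ a') (inj₁ b) q)) }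
    where
      open IsBij bθ
      image : ∀ a → Σ[ c ∈ EA ⊎ EB ] θ (inj₁ a) c → Σ[ b ∈ EA ] θA a b
      image a (inj₁ b , p) = b , f _ _ p
      image a (inj₂ b , p) = ⊥-elim (f _ _ p)
      preimage : ∀ b → Σ[ c ∈ EA ⊎ EB ] θ c (inj₁ b) → Σ[ a ∈ EA ] θA a b
      preimage b (inj₁ a , p) = a , f _ _ p
      preimage b (inj₂ a , p) = ⊥-elim (f _ _ p)

  IsBij-right : {x y : Subset (EA ⊎ EB)} {θ : BRel (EA ⊎ EB)}
                {θA : BRel EA} {θB : BRel EB} →
                IsBij x y θ → θ ≈R (θA ∥R θB) → IsBij (right x) (right y) θB
  IsBij-right {θ = θ} {θB = θB} bθ (f , g) = record
    { dom⊆ = λ a b p → dom⊆ (inj₂ a) (inj₂ b) (g _ _ p)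
    ; total = λ a xa → image a (total (inj₂ a) xa)
    ; surj = λ b yb → preimage b (surj (inj₂ b) yb)
    ; func = λ a b b' p q → inj₂-injective
        (func _ _ _ (g (inj₂ a) (inj₂ b) p) (g (inj₂ a) (inj₂ b') q))
    ; inj = λ a a' b p q → inj₂-injective
        (inj _ _ _ (g (inj₂ a) (inj₂ b) p) (g (inj₂ a') (inj₂ b) q)) }
    where
      open IsBij bθ
      image : ∀ a → Σ[ c ∈ EA ⊎ EB ] θ (inj₂ a) c → Σ[ b ∈ EB ] θB a b
      image a (inj₂ b , p) = b , f _ _ p
      image a (inj₁ b , p) = ⊥-elim (f _ _ p)
      preimage : ∀ b → Σ[ c ∈ EA ⊎ EB ] θ c (inj₂ b) → Σ[ a ∈ EB ] θB a b
      preimage b (inj₂ a , p) = a , f _ _ p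
      preimage b (inj₁ a , p) = ⊥-elim (f _ _ p)

  IsBij-∥ : {x y : Subset (EA ⊎ EB)} {θA : BRel EA} {θB : BRel EB} →
            IsBij (left x) (left y) θA → IsBij (right x) (right y) θB →
            IsBij x y (θA ∥R θB)
  IsBij-∥ {x} {y} {θA} {θB} bA bB = record
    { dom⊆ = dom⊆ ; total = total ; surj = surj ; func = func ; inj = inj }
    where
      module A = IsBij bA
      module B = IsBij bB
      θ : BRel (EA ⊎ EB)
      θ = θA ∥R θB

      dom⊆ : ∀ a b → θ a b → x a × y b
      dom⊆ (inj₁ a) (inj₁ b) p = A.dom⊆ a b p
      dom⊆ (inj₂ a) (inj₂ b) p = B.dom⊆ a b p

      total : ∀ a → x a → Σ[ b ∈ EA ⊎ EB ] θ a b
      total (inj₁ a) xa = let (b , p) = A.total a xa in inj₁ b , p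
      total (inj₂ a) xa = let (b , p) = B.total a xa in inj₂ b , p

      surj : ∀ b → y b → Σ[ a ∈ EA ⊎ EB ] θ a b
      surj (inj₁ b) yb = let (a , p) = A.surj b yb in inj₁ a , p
      surj (inj₂ b) yb = let (a , p) = B.surj b yb in inj₂ a , p

      func : ∀ a b b' → θ a b → θ a b' → b ≡ b'
      func (inj₁ a) (inj₁ b) (inj₁ b') p q = cong inj₁ (A.func a b b' p q)
      func (inj₂ a) (inj₂ b) (inj₂ b') p q = cong inj₂ (B.func a b b' p q)
      func (inj₁ a) (inj₁ b) (inj₂ b') p ()
      func (inj₂ a) (inj₂ b) (inj₁ b') p ()

      inj : ∀ a a' b → θ a b → θ a' b → a ≡ a'
      inj (inj₁ a) (inj₁ a') (inj₁ b) p q = cong inj₁ (A.inj a a' b p q)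
      inj (inj₂ a) (inj₂ a') (inj₂ b) p q = cong inj₂ (B.inj a a' b p q)
      inj (inj₁ a) (inj₂ a') (inj₁ b) p ()
      inj (inj₂ a) (inj₁ a') (inj₂ b) p ()

module _ (A B : GameData) where
  private
    module A = GameData A
    module B = GameData B

  Endo-split : {SA : BRel A.Ev → Set₁} {SB : BRel B.Ev → Set₁}
               {yA : Subset A.Ev} {yB : Subset B.Ev} {θ : BRel (A.Ev ⊎ B.Ev)} →
               Endo (A ∥ B) (Sym∥ SA SB) (yA ⊎ₛ yB) θ →
               Σ[ θA ∈ BRel A.Ev ] Σ[ θB ∈ BRel B.Ev ]
                 (Endo A SA yA θA × Endo B SB yB θB × θ ≈R (θA ∥R θB))
  Endo-split ((θA , θB , sA , sB , e) , bθ) =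
    θA , θB , (sA , IsBij-left bθ e) , (sB , IsBij-right bθ e) , e

  Endo-∥ : {SA : BRel A.Ev → Set₁} {SB : BRel B.Ev → Set₁}
           {yA : Subset A.Ev} {yB : Subset B.Ev} {θA : BRel A.Ev} {θB : BRel B.Ev} →
           Endo A SA yA θA → Endo B SB yB θB →
           Endo (A ∥ B) (Sym∥ SA SB) (yA ⊎ₛ yB) (θA ∥R θB)
  Endo-∥ (sA , bA) (sB , bB) = (_ , _ , sA , sB , ≈R-refl) , IsBij-∥ bA bB

  factorisation-∥ : {yA : Subset A.Ev} {yB : Subset B.Ev} {θ : BRel (A.Ev ⊎ B.Ev)}
                    {θA : BRel A.Ev} {θB : BRel B.Ev} → θ ≈R (θA ∥R θB) →
                    Factorisation A yA θA → Factorisation B yB θB →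
                    Factorisation (A ∥ B) (yA ⊎ₛ yB) θ
  factorisation-∥ e (α₊ , α₋ , tA₊ , tA₋ , eA) (β₊ , β₋ , tB₊ , tB₋ , eB) =
    α₊ ∥R β₊ , α₋ ∥R β₋ , Endo-∥ tA₊ tB₊ , Endo-∥ tA₋ tB₋ ,
    ≈R-trans e (≈R-trans (∥-cong eA eB) (≈R-sym ∥-⊙))

  uniqueness-∥ : {yA : Subset A.Ev} {yB : Subset B.Ev} {θ : BRel (A.Ev ⊎ B.Ev)}
                 {θA : BRel A.Ev} {θB : BRel B.Ev} → θ ≈R (θA ∥R θB) →
                 UniqueFactorisation A yA θA → UniqueFactorisation B yB θB →
                 UniqueFactorisation (A ∥ B) (yA ⊎ₛ yB) θ
  uniqueness-∥ e uniqA uniqB θ₊ θ₋ ψ₊ ψ₋ t₊ t₋ u₊ u₋ eθ eψ =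
    let (a₊ , b₊ , ta₊ , tb₊ , eθ₊) = Endo-split t₊
        (a₋ , b₋ , ta₋ , tb₋ , eθ₋) = Endo-split t₋
        (c₊ , d₊ , uc₊ , ud₊ , eψ₊) = Endo-split u₊
        (c₋ , d₋ , uc₋ , ud₋ , eψ₋) = Endo-split u₋
        (θA≈a , θB≈b) = ∥-factorisation-components e eθ₊ eθ₋ eθ
        (θA≈c , θB≈d) = ∥-factorisation-components e eψ₊ eψ₋ eψ
        (a₊≈c₊ , a₋≈c₋) = uniqA a₊ a₋ c₊ c₋ ta₊ ta₋ uc₊ uc₋ θA≈a θA≈c
        (b₊≈d₊ , b₋≈d₋) = uniqB b₊ b₋ d₊ d₋ tb₊ tb₋ ud₊ ud₋ θB≈b θB≈d
    in  ≈R-trans eθ₊ (≈R-trans (∥-cong a₊≈c₊ b₊≈d₊) (≈R-sym eψ₊)) ,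
        ≈R-trans eθ₋ (≈R-trans (∥-cong a₋≈c₋ b₋≈d₋) (≈R-sym eψ₋))

  canonical-∥ : {yA : Subset A.Ev} {yB : Subset B.Ev} →
                Canonical A yA → Canonical B yB → Canonical (A ∥ B) (yA ⊎ₛ yB)
  canonical-∥ canA canB θ endo =
    let (θA , θB , endoA , endoB , e) = Endo-split endo
        (factA , uniqA) = canA θA endoA
        (factB , uniqB) = canB θB endoB
    in  factorisation-∥ e factA factB , uniqueness-∥ e uniqA uniqB

  IsConfig-split : {X : Subset (A.Ev ⊎ B.Ev)} → IsConfig (A ∥ B) X →
                   IsConfig A (left X) × IsConfig B (right X)
  IsConfig-split ((conA , conB) , down) =
    (conA , λ e e' → down (inj₁ e) (inj₁ e')) , (conB , λ e e' → down (inj₂ e) (inj₂ e'))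

  IsConfig-∥ : {yA : Subset A.Ev} {yB : Subset B.Ev} →
               IsConfig A yA → IsConfig B yB → IsConfig (A ∥ B) (yA ⊎ₛ yB)
  IsConfig-∥ {yA} {yB} (conA , downA) (conB , downB) = (conA , conB) , down
    where
      down : ∀ e e' → (yA ⊎ₛ yB) e → ≤∥ A._≤_ B._≤_ e' e → (yA ⊎ₛ yB) e'
      down (inj₁ e) (inj₁ e') = downA e e'
      down (inj₂ e) (inj₂ e') = downB e e'
      down (inj₁ e) (inj₂ e') _ ()
      down (inj₂ e) (inj₁ e') _ ()

  representable-∥ : Representable A → Representable B → Representable (A ∥ B)
  representable-∥ repA repB X cX =
    let (cXA , cXB) = IsConfig-split cX
        (yA , cyA , (θA , sA , bA) , canA) = repA (left X) cXA
        (yB , cyB , (θB , sB , bB) , canB) = repB (right X) cXB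
    in  yA ⊎ₛ yB , IsConfig-∥ cyA cyB ,
        (θA ∥R θB , (θA , θB , sA , sB , ≈R-refl) , IsBij-∥ bA bB) ,
        canonical-∥ canA canB

mainTheorem3 : (A B : GameData) → IsTcg A → IsTcg B →
               Representable A → Representable B →
               Representable (A ⊥) × Representable (A ∥ B)
mainTheorem3 A B tcgA _ repA repB =
  representable-⊥ A tcgA repA , representable-∥ A B repA repB
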